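{- Let $q$ be an odd prime, let $r\in[1,q-1]$ be an integer such that $r^2\equiv -1\pmod q$, let $G=\langle \alpha,\tau:\ \alpha^q=1,\ \tau^4=1,\ \alpha\tau=\tau\alpha^r\rangle$, and let $G'=\langle\alpha\rangle=[G,G]$ be its commutator subgroup. Let $S$ be a sequence over $G$ such that its image $\phi_{G'}(S)$ is a minimal product-one sequence over $G/G'$. Then either $1\in\pi(S)$ or $|\pi(S)|\geq|S|$.
   Context: A sequence over a group $G$ is a finite unordered list of elements of $G$ with repetition allowed; its length $|S|$ is its number of terms with multiplicity. For a sequence $S$, $\pi(S)\subseteq G$ denotes the set of all products of the terms of $S$ taken over all orderings of its terms. A sequence is product-one if $1\in\pi(S)$; a minimal product-one sequence is a nonempty product-one sequence that cannot be partitioned into two nonempty product-one subsequences. $\phi_{G'}:G\to G/G'$ is the canonical projection, and $\phi_{G'}(S)$ is the sequence over $G/G'$ obtained by applying $\phi_{G'}$ to each term of $S$. -}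

module Defs where

open import Data.Nat using (ℕ; zero; suc; _+_; _*_; _^_; NonZero)
open import Data.Nat.DivMod using (_mod_)
open import Data.Fin using (Fin; toℕ)
open import Data.Product using (_×_; _,_; ∃; ∃₂; proj₁)
open import Data.List using (List; []; _++_; foldr; map)
open import Data.List.Relation.Binary.Permutation.Propositional using (_↭_)
open import Relation.Binary.PropositionalEquality using (_≡_; _≢_)
open import Relation.Nullary using (¬_)

-- Generic notions for sequences (finite lists, considered up to permutation)
-- over a set A with a binary operation _∙_ and identity e.
module Seq {A : Set} (_∙_ : A → A → A) (e : A) where

  prod : List A → A
  prod = foldr _∙_ e

  _∈π_ : A → List A → Set
  g ∈π S = ∃ λ T → (T ↭ S) × (prod T ≡ g)

  ProductOne : List A → Set
  ProductOne S = e ∈π S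

  MinimalProductOne : List A → Set
  MinimalProductOne S =
    (S ≢ []) × ProductOne S ×
    ¬ (∃₂ λ U V → (U ≢ []) × (V ≢ []) × ((U ++ V) ↭ S) × ProductOne U × ProductOne V)

-- The group G = ⟨α, τ | α^q = 1, τ^4 = 1, ατ = τα^r⟩, realised concretely:
-- the pair (j , i) stands for τ^j α^i  (j mod 4, i mod q).
-- Since α^i τ^l = τ^l α^(i r^l), we get
--   (τ^j α^i)(τ^l α^k) = τ^(j+l) α^(i r^l + k).
module Metacyclic (q r : ℕ) .{{_ : NonZero q}} where

  G : Set
  G = Fin 4 × Fin q

  _·_ : G → G → G
  (j , i) · (l , k) = ((toℕ j + toℕ l) mod 4) , ((toℕ i * r ^ toℕ l + toℕ k) mod q)

  one : G
  one = (0 mod 4) , (0 mod q)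

  -- the quotient G/G' = G/⟨α⟩ ≅ ℤ/4, generated by the image of τ
  Q : Set
  Q = Fin 4

  _⊕_ : Q → Q → Q
  a ⊕ b = (toℕ a + toℕ b) mod 4

  zeroQ : Q
  zeroQ = 0 mod 4

  φ : G → Q
  φ = proj₁

  φSeq : List G → List Q
  φSeq = map φ

  module SG = Seq _·_ one
  module SQ = Seq _⊕_ zeroQ

-- In G/G' ≅ ℤ/4 the image of S is a minimal zero-sum sequence, so the partial sums of
-- its proper prefixes P (taken in a fixed ordering P Q of S) are pairwise distinct: two
-- equal ones would cut out a nonempty proper zero-sum block. The product of S in that
-- ordering lies in G' = ⟨α⟩, say α^c, and then the rotation Q P has product
-- α^(c r^e), where e is the τ-exponent of P. If c = 0 then 1 ∈ π(S); otherwise r has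
-- order 4 modulo q (r² ≡ -1 and q is odd), so the |S| rotations have pairwise distinct
-- products, all in π(S).
module Submission where

open import Defs
open import Level using (0ℓ)
open import Algebra.Core using (Op₂)
open import Algebra.Definitions using (LeftCancellative)
open import Algebra.Structures using (IsCommutativeMonoid)
open import Algebra.Structures.Biased using (isCommutativeMonoidˡ)
open import Data.Empty using (⊥-elim)
open import Data.Nat
  using (ℕ; zero; suc; _+_; _*_; _^_; _%_; _/_; _≤_; _<_; _∸_; s≤s; z<s; pred; NonZero; >-nonZero⁻¹)
open import Data.Nat.Properties
  using (suc-pred; +-assoc; +-comm; +-identityʳ; +-suc; *-assoc; *-comm; *-identityʳ; *-zeroʳ;
         ^-distribˡ-+-*; ^-*-assoc; ^-zeroˡ; ≤-reflexive; ≤-<-trans; m≤n+m; <-cmp; m≤n⇒∃[o]m+o≡n)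
open import Data.Nat.DivMod
  using (_mod_; m<n⇒m%n≡m; m%n<n; %-distribˡ-+; %-distribˡ-*; m%n%n≡m%n; %-remove-+ʳ; m≡m%n+[m/n]*n)
open import Data.Nat.Divisibility using (_∣_; n∣m*n; n∣m⇒m%n≡0; m%n≡0⇒n∣m)
open import Data.Nat.Primality using (Prime; euclidsLemma; prime⇒irreducible; prime[2]; ¬prime[1])
open import Data.Nat.Tactic.RingSolver using (solve-∀)
open import Data.Fin using (Fin; toℕ; _≟_)
open import Data.Fin.Properties using (toℕ-fromℕ<; toℕ-injective; toℕ<n)
open import Data.List using (List; []; _∷_; _++_; map; length)
open import Data.List.Properties using (map-∘; map-++; map-cong; map-cong-local; length-map)
import Data.List.Properties as List
open import Data.List.Relation.Unary.All as All using (All; []; _∷_)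
import Data.List.Relation.Unary.All.Properties as All
open import Data.List.Relation.Unary.AllPairs using ([]; _∷_)
open import Data.List.Relation.Unary.Unique.Propositional using (Unique)
import Data.List.Relation.Unary.Unique.Propositional.Properties as Unique
open import Data.List.Relation.Binary.Permutation.Propositional
  using (_↭_; ↭-refl; ↭-trans; ↭-reflexive; ↭⇒↭ₛ)
import Data.List.Relation.Binary.Permutation.Propositional.Properties as ↭
open import Data.List.Relation.Binary.Permutation.Setoid.Properties using (foldr-commMonoid)
open import Data.Product using (_×_; _,_; proj₁; proj₂; ∃; map₁)
import Data.Product as Product
open import Data.Sum using (_⊎_; inj₁; inj₂; [_,_]′)
open import Function using (_∘_; id; case_of_)
open import Relation.Binary.Bundles using (Setoid)
import Relation.Binary.Construct.On as On
import Relation.Binary.Reasoning.Setoid as SetoidReasoning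
open import Relation.Binary.PropositionalEquality
  using (_≡_; _≢_; refl; cong; cong₂; sym; trans; subst; setoid; isEquivalence; module ≡-Reasoning)
open import Relation.Nullary using (¬_; yes; no)
open import Relation.Binary.Definitions using (tri<; tri≈; tri>)

module Congruence (n : ℕ) .{{_ : NonZero n}} where

  infix 4 _≋_
  _≋_ : ℕ → ℕ → Set
  a ≋ b = a % n ≡ b % n

  ≋-setoid : Setoid 0ℓ 0ℓ
  ≋-setoid = On.setoid (setoid ℕ) (_% n)

  module ≋-Reasoning = SetoidReasoning ≋-setoid

  ≡⇒≋ : ∀ {a b} → a ≡ b → a ≋ b
  ≡⇒≋ = cong (_% n)

  %-≋ : ∀ a → a % n ≋ a
  %-≋ a = m%n%n≡m%n a n

  +-≋ : ∀ {a b c d} → a ≋ b → c ≋ d → a + c ≋ b + d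
  +-≋ {a} {b} {c} {d} a≋b c≋d = trans (%-distribˡ-+ a c n)
    (trans (cong₂ (λ x y → (x + y) % n) a≋b c≋d) (sym (%-distribˡ-+ b d n)))

  *-≋ : ∀ {a b c d} → a ≋ b → c ≋ d → a * c ≋ b * d
  *-≋ {a} {b} {c} {d} a≋b c≋d = trans (%-distribˡ-* a c n)
    (trans (cong₂ (λ x y → (x * y) % n) a≋b c≋d) (sym (%-distribˡ-* b d n)))

  *-≋ˡ : ∀ c {a b} → a ≋ b → c * a ≋ c * b
  *-≋ˡ c = *-≋ {c} {c} refl

  *-≋ʳ : ∀ c {a b} → a ≋ b → a * c ≋ b * c
  *-≋ʳ c a≋b = *-≋ a≋b (refl {x = c % n})

  ^-≋ : ∀ {a b} k → a ≋ b → a ^ k ≋ b ^ k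
  ^-≋ zero    a≋b = refl
  ^-≋ (suc k) a≋b = *-≋ a≋b (^-≋ k a≋b)

  ∣⇒≋0 : ∀ {a} → n ∣ a → a ≋ 0
  ∣⇒≋0 {a} n∣a = trans (n∣m⇒m%n≡0 a n n∣a) (sym (m<n⇒m%n≡m (>-nonZero⁻¹ n)))

  ≋0⇒∣ : ∀ {a} → a ≋ 0 → n ∣ a
  ≋0⇒∣ {a} a≋0 = m%n≡0⇒n∣m a n (trans a≋0 (m<n⇒m%n≡m (>-nonZero⁻¹ n)))

  +-cancelˡ-≋ : ∀ k a b → k + a ≋ k + b → a ≋ b
  +-cancelˡ-≋ k a b k+a≋k+b = begin
    a                      ≈⟨ %-remove-+ʳ a (n∣m*n k) ⟨
    a + k * n              ≡⟨ regroup a ⟩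
    (k + a) + k * pred n   ≈⟨ +-≋ k+a≋k+b refl ⟩
    (k + b) + k * pred n   ≡⟨ regroup b ⟨
    b + k * n              ≈⟨ %-remove-+ʳ b (n∣m*n k) ⟩
    b                      ∎
    where
    open ≋-Reasoning
    regroup : ∀ x → x + k * n ≡ (k + x) + k * pred n
    regroup x = trans (cong (λ m → x + k * m) (sym (suc-pred n))) (shift x k (pred n))
      where
      shift : ∀ x k p → x + k * suc p ≡ (k + x) + k * p
      shift = solve-∀

module ModularAddition (n : ℕ) .{{_ : NonZero n}} where
  open Congruence n

  infixl 6 _⊕_
  _⊕_ : Fin n → Fin n → Fin n
  a ⊕ b = (toℕ a + toℕ b) mod n

  0ₙ : Fin n
  0ₙ = 0 mod n

  toℕ-mod : ∀ a → toℕ (a mod n) ≋ a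
  toℕ-mod a = trans (cong (_% n) (toℕ-fromℕ< _)) (%-≋ a)

  toℕ-≋-injective : ∀ {a b : Fin n} → toℕ a ≋ toℕ b → a ≡ b
  toℕ-≋-injective {a} {b} a≋b = toℕ-injective
    (trans (sym (m<n⇒m%n≡m (toℕ<n a))) (trans a≋b (m<n⇒m%n≡m (toℕ<n b))))

  ⊕-assoc : ∀ a b c → (a ⊕ b) ⊕ c ≡ a ⊕ (b ⊕ c)
  ⊕-assoc a b c = toℕ-≋-injective (begin
    toℕ ((a ⊕ b) ⊕ c)          ≈⟨ toℕ-mod _ ⟩
    toℕ (a ⊕ b) + toℕ c        ≈⟨ +-≋ (toℕ-mod _) refl ⟩
    toℕ a + toℕ b + toℕ c      ≡⟨ +-assoc (toℕ a) (toℕ b) (toℕ c) ⟩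
    toℕ a + (toℕ b + toℕ c)    ≈⟨ +-≋ (refl {x = toℕ a % n}) (toℕ-mod _) ⟨
    toℕ a + toℕ (b ⊕ c)        ≈⟨ toℕ-mod _ ⟨
    toℕ (a ⊕ (b ⊕ c))          ∎)
    where open ≋-Reasoning

  ⊕-comm : ∀ a b → a ⊕ b ≡ b ⊕ a
  ⊕-comm a b = cong (_mod n) (+-comm (toℕ a) (toℕ b))

  ⊕-identityˡ : ∀ a → 0ₙ ⊕ a ≡ a
  ⊕-identityˡ a = toℕ-≋-injective (trans (toℕ-mod _) (+-≋ (toℕ-mod 0) (refl {x = toℕ a % n})))

  ⊕-cancelˡ : LeftCancellative _≡_ _⊕_
  ⊕-cancelˡ a b c a⊕b≡a⊕c = toℕ-≋-injective (+-cancelˡ-≋ (toℕ a) (toℕ b) (toℕ c)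
    (trans (sym (toℕ-mod _)) (trans (cong (λ x → toℕ x % n) a⊕b≡a⊕c) (toℕ-mod _))))

  ⊕-isCommutativeMonoid : IsCommutativeMonoid _≡_ _⊕_ 0ₙ
  ⊕-isCommutativeMonoid = isCommutativeMonoidˡ record
    { isSemigroup = record
      { isMagma = record { isEquivalence = isEquivalence ; ∙-cong = cong₂ _⊕_ }
      ; assoc   = ⊕-assoc
      }
    ; identityˡ = ⊕-identityˡ
    ; comm      = ⊕-comm
    }

module RootOfUnity (n : ℕ) .{{_ : NonZero n}} (r d : ℕ) .{{_ : NonZero d}}
                   (rᵈ≋1 : Congruence._≋_ n (r ^ d) 1) where
  open Congruence n
  open ModularAddition d using (_⊕_)

  ^-≋-%-exponent : ∀ k → r ^ k ≋ r ^ (k % d)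
  ^-≋-%-exponent k = begin
    r ^ k                            ≡⟨ cong (r ^_) (m≡m%n+[m/n]*n k d) ⟩
    r ^ (k % d + k / d * d)          ≡⟨ ^-distribˡ-+-* r (k % d) (k / d * d) ⟩
    r ^ (k % d) * r ^ (k / d * d)    ≡⟨ cong (λ e → r ^ (k % d) * r ^ e) (*-comm (k / d) d) ⟩
    r ^ (k % d) * r ^ (d * (k / d))  ≡⟨ cong (r ^ (k % d) *_) (^-*-assoc r d (k / d)) ⟨
    r ^ (k % d) * (r ^ d) ^ (k / d)  ≈⟨ *-≋ˡ (r ^ (k % d)) (^-≋ (k / d) rᵈ≋1) ⟩
    r ^ (k % d) * 1 ^ (k / d)        ≡⟨ cong (r ^ (k % d) *_) (^-zeroˡ (k / d)) ⟩
    r ^ (k % d) * 1                  ≡⟨ *-identityʳ (r ^ (k % d)) ⟩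
    r ^ (k % d)                      ∎
    where open ≋-Reasoning

  ^-⊕ : ∀ a b → r ^ toℕ (a ⊕ b) ≋ r ^ toℕ a * r ^ toℕ b
  ^-⊕ a b = begin
    r ^ toℕ (a ⊕ b)              ≡⟨ cong (r ^_) (toℕ-fromℕ< (m%n<n (toℕ a + toℕ b) d)) ⟩
    r ^ ((toℕ a + toℕ b) % d)    ≈⟨ ^-≋-%-exponent (toℕ a + toℕ b) ⟨
    r ^ (toℕ a + toℕ b)          ≡⟨ ^-distribˡ-+-* r (toℕ a) (toℕ b) ⟩
    r ^ toℕ a * r ^ toℕ b        ∎
    where open ≋-Reasoning

  ^-inverse : ∀ a → r ^ a * r ^ (pred d * a) ≋ 1
  ^-inverse a = begin
    r ^ a * r ^ (pred d * a)   ≡⟨ ^-distribˡ-+-* r a (pred d * a) ⟨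
    r ^ (suc (pred d) * a)     ≡⟨ cong (λ m → r ^ (m * a)) (suc-pred d) ⟩
    r ^ (d * a)                ≡⟨ ^-*-assoc r d a ⟨
    (r ^ d) ^ a                ≈⟨ ^-≋ a rᵈ≋1 ⟩
    1 ^ a                      ≡⟨ ^-zeroˡ a ⟩
    1                          ∎
    where open ≋-Reasoning

  *-cancelʳ-^ : ∀ x y a → x * r ^ a ≋ y * r ^ a → x ≋ y
  *-cancelʳ-^ x y a xrᵃ≋yrᵃ = begin
    x                             ≈⟨ cancel x ⟨
    x * r ^ a * r ^ (pred d * a)  ≈⟨ *-≋ʳ (r ^ (pred d * a)) xrᵃ≋yrᵃ ⟩
    y * r ^ a * r ^ (pred d * a)  ≈⟨ cancel y ⟩
    y                             ∎
    where
    open ≋-Reasoning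
    cancel : ∀ z → z * r ^ a * r ^ (pred d * a) ≋ z
    cancel z = begin
      z * r ^ a * r ^ (pred d * a)    ≡⟨ *-assoc z (r ^ a) (r ^ (pred d * a)) ⟩
      z * (r ^ a * r ^ (pred d * a))  ≈⟨ *-≋ˡ z (^-inverse a) ⟩
      z * 1                           ≡⟨ *-identityʳ z ⟩
      z                               ∎

splits : {B : Set} → List B → List (List B × List B)
splits []       = []
splits (x ∷ xs) = ([] , x ∷ xs) ∷ map (map₁ (x ∷_)) (splits xs)

splits-sound : {B : Set} (xs : List B) → All (λ (P , Q) → P ++ Q ≡ xs × Q ≢ []) (splits xs)
splits-sound []       = []
splits-sound (x ∷ xs) = (refl , λ ()) ∷ All.map⁺ (All.map (map₁ (cong (x ∷_))) (splits-sound xs))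

length-splits : {B : Set} (xs : List B) → length (splits xs) ≡ length xs
length-splits []       = refl
length-splits (x ∷ xs) = cong suc (trans (length-map _ (splits xs)) (length-splits xs))

splits-map : {B C : Set} (f : B → C) (xs : List B) →
             splits (map f xs) ≡ map (Product.map (map f) (map f)) (splits xs)
splits-map f []       = refl
splits-map f (x ∷ xs) = cong (([] , f x ∷ map f xs) ∷_)
  (trans (cong (map (map₁ (f x ∷_))) (splits-map f xs)) (trans (sym (map-∘ (splits xs))) (map-∘ (splits xs))))

module Rotations {A : Set} (_∙_ : Op₂ A) (e : A) where
  open Seq _∙_ e

  rotations : List A → List A
  rotations S = map (λ (P , Q) → prod (Q ++ P)) (splits S)

  length-rotations : ∀ S → length (rotations S) ≡ length S
  length-rotations S = trans (length-map _ (splits S)) (length-splits S)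

  rotations-∈π : ∀ S → All (_∈π S) (rotations S)
  rotations-∈π S = All.map⁺ (All.map rotation-∈π (splits-sound S))
    where
    rotation-∈π : ∀ {s} → proj₁ s ++ proj₂ s ≡ S × proj₂ s ≢ [] →
                  prod (proj₂ s ++ proj₁ s) ∈π S
    rotation-∈π {P , Q} (P++Q≡S , _) = Q ++ P , ↭-trans (↭.++-comm Q P) (↭-reflexive P++Q≡S) , refl

module CommutativeSequences {A : Set} {_∙_ : Op₂ A} {e : A}
                            (isCommutativeMonoid : IsCommutativeMonoid _≡_ _∙_ e) where
  open IsCommutativeMonoid isCommutativeMonoid using (assoc; identityˡ)
  open Seq _∙_ e

  prod-++ : ∀ xs ys → prod (xs ++ ys) ≡ prod xs ∙ prod ys
  prod-++ []       ys = sym (identityˡ (prod ys))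
  prod-++ (x ∷ xs) ys = trans (cong (x ∙_) (prod-++ xs ys)) (sym (assoc x (prod xs) (prod ys)))

  prod-↭ : ∀ {xs ys} → xs ↭ ys → prod xs ≡ prod ys
  prod-↭ = foldr-commMonoid (setoid A) isCommutativeMonoid ∘ ↭⇒↭ₛ

  productOne⇒prod≡e : ∀ {xs} → ProductOne xs → prod xs ≡ e
  productOne⇒prod≡e (T , T↭xs , prodT≡e) = trans (sym (prod-↭ T↭xs)) prodT≡e

  NoProperProductOneInfix : List A → Set
  NoProperProductOneInfix xs = ∀ P M R → P ++ M ++ R ≡ xs → M ≢ [] → P ++ R ≢ [] → prod M ≢ e

  minimal⇒noProperProductOneInfix : ∀ {xs} → MinimalProductOne xs → NoProperProductOneInfix xs
  minimal⇒noProperProductOneInfix {xs} (_ , xs-one , indecomposable) P M R split M≢[] P++R≢[] prodM≡e =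
    indecomposable (M , P ++ R , M≢[] , P++R≢[] , M++P++R↭xs ,
                    (M , ↭-refl , prodM≡e) , (P ++ R , ↭-refl , prodP++R≡e))
    where
    M++P++R↭xs : M ++ P ++ R ↭ xs
    M++P++R↭xs = ↭-trans (↭-reflexive (sym (List.++-assoc M P R)))
                   (↭-trans (↭.++⁺ʳ R (↭.++-comm M P)) (↭-reflexive (trans (List.++-assoc P M R) split)))
    prodP++R≡e : prod (P ++ R) ≡ e
    prodP++R≡e = begin
      prod (P ++ R)            ≡⟨ identityˡ _ ⟨
      e ∙ prod (P ++ R)        ≡⟨ cong (_∙ prod (P ++ R)) prodM≡e ⟨
      prod M ∙ prod (P ++ R)   ≡⟨ prod-++ M (P ++ R) ⟨
      prod (M ++ P ++ R)       ≡⟨ prod-↭ M++P++R↭xs ⟩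
      prod xs                  ≡⟨ productOne⇒prod≡e xs-one ⟩
      e                        ∎
      where open ≡-Reasoning

  prefixProducts-unique : LeftCancellative _≡_ _∙_ → ∀ xs → NoProperProductOneInfix xs →
                          Unique (map (prod ∘ proj₁) (splits xs))
  prefixProducts-unique cancel []       _       = []
  prefixProducts-unique cancel (x ∷ xs) noInfix =
    All.map⁺ (All.map⁺ (All.map e≢ (splits-sound xs)))
    ∷ subst Unique (trans (sym (map-∘ (splits xs))) (map-∘ (splits xs)))
        (Unique.map⁺ (cancel x _ _) (prefixProducts-unique cancel xs tailNoInfix))
    where
    e≢ : ∀ {s} → proj₁ s ++ proj₂ s ≡ xs × proj₂ s ≢ [] → e ≢ x ∙ prod (proj₁ s)
    e≢ {P , Q} (P++Q≡xs , Q≢[]) e≡ = noInfix [] (x ∷ P) Q (cong (x ∷_) P++Q≡xs) (λ ()) Q≢[] (sym e≡)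
    tailNoInfix : NoProperProductOneInfix xs
    tailNoInfix P M R split M≢[] _ = noInfix (x ∷ P) M R (cong (x ∷_) split) M≢[] (λ ())

module MetacyclicProducts (q r : ℕ) .{{_ : NonZero q}} (r⁴≋1 : Congruence._≋_ q (r ^ 4) 1) where
  open Congruence q
  open Metacyclic q r
  open ModularAddition q using (toℕ-mod; toℕ-≋-injective)
  open ModularAddition 4 using (⊕-isCommutativeMonoid; ⊕-comm; ⊕-cancelˡ)
  open CommutativeSequences ⊕-isCommutativeMonoid
    using (prod-++; productOne⇒prod≡e; minimal⇒noProperProductOneInfix; prefixProducts-unique)
  open RootOfUnity q r 4 r⁴≋1 using (^-⊕)

  τ-exp : List G → Q
  τ-exp xs = proj₁ (SG.prod xs)

  α-exp : List G → ℕ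
  α-exp xs = toℕ (proj₂ (SG.prod xs))

  τ-exp≡prod∘φSeq : ∀ xs → τ-exp xs ≡ SQ.prod (φSeq xs)
  τ-exp≡prod∘φSeq []       = refl
  τ-exp≡prod∘φSeq (x ∷ xs) = cong (φ x ⊕_) (τ-exp≡prod∘φSeq xs)

  τ-exp-++ : ∀ xs ys → τ-exp (xs ++ ys) ≡ τ-exp xs ⊕ τ-exp ys
  τ-exp-++ xs ys = begin
    τ-exp (xs ++ ys)                         ≡⟨ τ-exp≡prod∘φSeq (xs ++ ys) ⟩
    SQ.prod (φSeq (xs ++ ys))                ≡⟨ cong SQ.prod (map-++ φ xs ys) ⟩
    SQ.prod (φSeq xs ++ φSeq ys)             ≡⟨ prod-++ (φSeq xs) (φSeq ys) ⟩
    SQ.prod (φSeq xs) ⊕ SQ.prod (φSeq ys)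
      ≡⟨ cong₂ _⊕_ (τ-exp≡prod∘φSeq xs) (τ-exp≡prod∘φSeq ys) ⟨
    τ-exp xs ⊕ τ-exp ys                      ∎
    where open ≡-Reasoning

  α-exp-∷ : ∀ x xs → α-exp (x ∷ xs) ≋ toℕ (proj₂ x) * r ^ toℕ (τ-exp xs) + α-exp xs
  α-exp-∷ x xs = toℕ-mod _

  α-exp-++ : ∀ xs ys → α-exp (xs ++ ys) ≋ α-exp xs * r ^ toℕ (τ-exp ys) + α-exp ys
  α-exp-++ []       ys = sym (+-≋ (*-≋ʳ (r ^ toℕ (τ-exp ys)) (toℕ-mod 0)) (refl {x = α-exp ys % q}))
  α-exp-++ (x ∷ xs) ys = begin
    α-exp (x ∷ xs ++ ys)                                ≈⟨ α-exp-∷ x (xs ++ ys) ⟩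
    i * r ^ toℕ (τ-exp (xs ++ ys)) + α-exp (xs ++ ys)   ≈⟨ +-≋ (*-≋ˡ i rτ) (α-exp-++ xs ys) ⟩
    i * (rˣ * rʸ) + (α-exp xs * rʸ + α-exp ys)          ≡⟨ distrib i rˣ rʸ (α-exp xs) (α-exp ys) ⟩
    (i * rˣ + α-exp xs) * rʸ + α-exp ys                 ≈⟨ +-≋ (*-≋ʳ rʸ (α-exp-∷ x xs)) refl ⟨
    α-exp (x ∷ xs) * rʸ + α-exp ys                      ∎
    where
    open ≋-Reasoning
    i rˣ rʸ : ℕ
    i = toℕ (proj₂ x)
    rˣ = r ^ toℕ (τ-exp xs)
    rʸ = r ^ toℕ (τ-exp ys)
    distrib : ∀ i a b h k → i * (a * b) + (h * b + k) ≡ (i * a + h) * b + k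
    distrib = solve-∀
    rτ : r ^ toℕ (τ-exp (xs ++ ys)) ≋ rˣ * rʸ
    rτ = trans (≡⇒≋ (cong (λ t → r ^ toℕ t) (τ-exp-++ xs ys))) (^-⊕ (τ-exp xs) (τ-exp ys))

  αPower : ℕ → Q → G
  αPower c a = (zeroQ , (c * r ^ toℕ a) mod q)

  rotation : ∀ xs ys → τ-exp (xs ++ ys) ≡ zeroQ →
             SG.prod (ys ++ xs) ≡ αPower (α-exp (xs ++ ys)) (τ-exp xs)
  rotation xs ys τ≡0 = cong₂ _,_ τ-rotated (toℕ-≋-injective α-rotated)
    where
    rˣ rʸ : ℕ
    rˣ = r ^ toℕ (τ-exp xs)
    rʸ = r ^ toℕ (τ-exp ys)
    τ-rotated : τ-exp (ys ++ xs) ≡ zeroQ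
    τ-rotated = begin
      τ-exp (ys ++ xs)        ≡⟨ τ-exp-++ ys xs ⟩
      τ-exp ys ⊕ τ-exp xs     ≡⟨ ⊕-comm (τ-exp ys) (τ-exp xs) ⟩
      τ-exp xs ⊕ τ-exp ys     ≡⟨ τ-exp-++ xs ys ⟨
      τ-exp (xs ++ ys)        ≡⟨ τ≡0 ⟩
      zeroQ                   ∎
      where open ≡-Reasoning
    rʸrˣ≋1 : rʸ * rˣ ≋ 1
    rʸrˣ≋1 = begin
      rʸ * rˣ                           ≈⟨ ^-⊕ (τ-exp ys) (τ-exp xs) ⟨
      r ^ toℕ (τ-exp ys ⊕ τ-exp xs)
        ≡⟨ cong (λ t → r ^ toℕ t) (trans (sym (τ-exp-++ ys xs)) τ-rotated) ⟩
      1                                 ∎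
      where open ≋-Reasoning
    α-rotated : α-exp (ys ++ xs) ≋ toℕ ((α-exp (xs ++ ys) * rˣ) mod q)
    α-rotated = begin
      α-exp (ys ++ xs)                      ≈⟨ α-exp-++ ys xs ⟩
      α-exp ys * rˣ + α-exp xs              ≡⟨ swap (α-exp xs) (α-exp ys) rˣ ⟩
      α-exp xs * 1 + α-exp ys * rˣ          ≈⟨ +-≋ (*-≋ˡ (α-exp xs) rʸrˣ≋1) refl ⟨
      α-exp xs * (rʸ * rˣ) + α-exp ys * rˣ  ≡⟨ distrib (α-exp xs) (α-exp ys) rʸ rˣ ⟩
      (α-exp xs * rʸ + α-exp ys) * rˣ       ≈⟨ *-≋ʳ rˣ (α-exp-++ xs ys) ⟨
      α-exp (xs ++ ys) * rˣ                 ≈⟨ toℕ-mod _ ⟨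
      toℕ ((α-exp (xs ++ ys) * rˣ) mod q)   ∎
      where
      open ≋-Reasoning
      swap : ∀ a b c → b * c + a ≡ a * 1 + b * c
      swap = solve-∀
      distrib : ∀ a b c d → a * (c * d) + b * d ≡ (a * c + b) * d
      distrib = solve-∀

  rotations-as-αPowers : ∀ S → τ-exp S ≡ zeroQ →
                         All (λ (P , Q) → SG.prod (Q ++ P) ≡ αPower (α-exp S) (τ-exp P)) (splits S)
  rotations-as-αPowers S τ≡0 = All.map as-αPower (splits-sound S)
    where
    as-αPower : ∀ {s} → proj₁ s ++ proj₂ s ≡ S × proj₂ s ≢ [] →
                SG.prod (proj₂ s ++ proj₁ s) ≡ αPower (α-exp S) (τ-exp (proj₁ s))
    as-αPower {P , Q} (P++Q≡S , _) = trans (rotation P Q (trans (cong τ-exp P++Q≡S) τ≡0))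
                                          (cong (λ T → αPower (α-exp T) (τ-exp P)) P++Q≡S)

  prefix-τ-exps : ∀ S → map (SQ.prod ∘ proj₁) (splits (φSeq S)) ≡ map (τ-exp ∘ proj₁) (splits S)
  prefix-τ-exps S = begin
    map (SQ.prod ∘ proj₁) (splits (φSeq S))                         ≡⟨ cong (map _) (splits-map φ S) ⟩
    map (SQ.prod ∘ proj₁) (map (Product.map φSeq φSeq) (splits S))  ≡⟨ map-∘ (splits S) ⟨
    map (SQ.prod ∘ φSeq ∘ proj₁) (splits S)
      ≡⟨ map-cong (sym ∘ τ-exp≡prod∘φSeq ∘ proj₁) (splits S) ⟩
    map (τ-exp ∘ proj₁) (splits S)                                  ∎
    where open ≡-Reasoning

  module _ {S : List G} (minimal : SQ.MinimalProductOne (φSeq S)) where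

    minimal⇒τ-exp≡0 : τ-exp S ≡ zeroQ
    minimal⇒τ-exp≡0 = trans (τ-exp≡prod∘φSeq S) (productOne⇒prod≡e (proj₁ (proj₂ minimal)))

    minimal⇒prefix-τ-exps-unique : Unique (map (τ-exp ∘ proj₁) (splits S))
    minimal⇒prefix-τ-exps-unique = subst Unique (prefix-τ-exps S)
      (prefixProducts-unique ⊕-cancelˡ (φSeq S) (minimal⇒noProperProductOneInfix minimal))

module OrderFour (q r : ℕ) .{{_ : NonZero q}}
                 (q-prime : Prime q) (q≢2 : q ≢ 2) (q∣r²+1 : q ∣ r * r + 1) where
  open Congruence q

  r²+1≋0 : r * r + 1 ≋ 0
  r²+1≋0 = ∣⇒≋0 q∣r²+1

  r⁴≋1 : r ^ 4 ≋ 1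
  r⁴≋1 = +-cancelˡ-≋ (r * r) (r ^ 4) 1 (begin
    r * r + r ^ 4          ≡⟨ factor r ⟩
    r * r * (r * r + 1)    ≈⟨ *-≋ˡ (r * r) r²+1≋0 ⟩
    r * r * 0              ≡⟨ *-zeroʳ (r * r) ⟩
    0                      ≈⟨ r²+1≋0 ⟨
    r * r + 1              ∎)
    where
    open ≋-Reasoning
    -- Powers are unfolded in the solver's goals: it does not recognise _^_.
    factor : ∀ r → r * r + r * (r * (r * (r * 1))) ≡ r * r * (r * r + 1)
    factor = solve-∀

  open RootOfUnity q r 4 r⁴≋1 using (*-cancelʳ-^)

  q∤2 : ¬ q ∣ 2
  q∤2 q∣2 with prime⇒irreducible prime[2] q∣2
  ... | inj₁ q≡1 = ¬prime[1] (subst Prime q≡1 q-prime)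
  ... | inj₂ q≡2 = q≢2 q≡2

  c+c≋0⇒c≋0 : ∀ c → c + c ≋ 0 → c ≋ 0
  c+c≋0⇒c≋0 c c+c≋0 = ∣⇒≋0 ([ ⊥-elim ∘ q∤2 , id ]′ (euclidsLemma 2 c q-prime q∣2c))
    where
    q∣2c : q ∣ 2 * c
    q∣2c = ≋0⇒∣ (subst (_≋ 0) (cong (c +_) (sym (+-identityʳ c))) c+c≋0)

  fixed-by-r²⇒≋0 : ∀ c → c * r ^ 2 ≋ c → c ≋ 0
  fixed-by-r²⇒≋0 c fixed = c+c≋0⇒c≋0 c (begin
    c + c              ≈⟨ +-≋ fixed refl ⟨
    c * r ^ 2 + c      ≡⟨ factor c r ⟩
    c * (r * r + 1)    ≈⟨ *-≋ˡ c r²+1≋0 ⟩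
    c * 0              ≡⟨ *-zeroʳ c ⟩
    0                  ∎)
    where
    open ≋-Reasoning
    factor : ∀ c r → c * (r * (r * 1)) + c ≡ c * (r * r + 1)
    factor = solve-∀

  fixed-by-r⇒≋0 : ∀ c → c * r ^ 1 ≋ c → c ≋ 0
  fixed-by-r⇒≋0 c fixed = fixed-by-r²⇒≋0 c (begin
    c * r ^ 2          ≡⟨ peel c r ⟩
    c * r ^ 1 * r      ≈⟨ *-≋ʳ r fixed ⟩
    c * r              ≡⟨ *-identityʳ (c * r) ⟨
    c * r * 1          ≡⟨ *-assoc c r 1 ⟩
    c * r ^ 1          ≈⟨ fixed ⟩
    c                  ∎)
    where
    open ≋-Reasoning
    peel : ∀ c r → c * (r * (r * 1)) ≡ c * (r * 1) * r
    peel = solve-∀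

  fixed-by-r³⇒≋0 : ∀ c → c * r ^ 3 ≋ c → c ≋ 0
  fixed-by-r³⇒≋0 c fixed = fixed-by-r⇒≋0 c (begin
    c * r ^ 1          ≡⟨ peel c r ⟩
    c * r              ≈⟨ *-≋ʳ r fixed ⟨
    c * r ^ 3 * r      ≡⟨ collect c r ⟩
    c * r ^ 4          ≈⟨ *-≋ˡ c r⁴≋1 ⟩
    c * 1              ≡⟨ *-identityʳ c ⟩
    c                  ∎)
    where
    open ≋-Reasoning
    peel : ∀ c r → c * (r * 1) ≡ c * r
    peel = solve-∀
    collect : ∀ c r → c * (r * (r * (r * 1))) * r ≡ c * (r * (r * (r * (r * 1))))
    collect = solve-∀

  no-fixed-point : ∀ {c} → ¬ c ≋ 0 → ∀ k → 0 < k → k < 4 → ¬ c * r ^ k ≋ c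
  no-fixed-point c≢0 1 _ _ = c≢0 ∘ fixed-by-r⇒≋0 _
  no-fixed-point c≢0 2 _ _ = c≢0 ∘ fixed-by-r²⇒≋0 _
  no-fixed-point c≢0 3 _ _ = c≢0 ∘ fixed-by-r³⇒≋0 _
  no-fixed-point c≢0 (suc (suc (suc (suc k)))) _ (s≤s (s≤s (s≤s (s≤s ()))))

  ^-injective-< : ∀ {c} → ¬ c ≋ 0 → ∀ {a b} → a < b → b < 4 → ¬ c * r ^ a ≋ c * r ^ b
  ^-injective-< {c} c≢0 {a} a<b b<4 crᵃ≋crᵇ with m≤n⇒∃[o]m+o≡n a<b
  ... | k , refl = no-fixed-point c≢0 (suc k) z<s (≤-<-trans (s≤s (m≤n+m k a)) b<4)
    (*-cancelʳ-^ (c * r ^ suc k) c a (begin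
      c * r ^ suc k * r ^ a      ≡⟨ shift c (r ^ a) (r ^ suc k) ⟩
      c * (r ^ a * r ^ suc k)    ≡⟨ cong (c *_) (^-distribˡ-+-* r a (suc k)) ⟨
      c * r ^ (a + suc k)        ≡⟨ cong (λ e → c * r ^ e) (+-suc a k) ⟩
      c * r ^ (suc a + k)        ≈⟨ crᵃ≋crᵇ ⟨
      c * r ^ a                  ∎))
    where
    open ≋-Reasoning
    shift : ∀ c x y → c * y * x ≡ c * (x * y)
    shift = solve-∀

  ^-injective : ∀ {c} → ¬ c ≋ 0 → ∀ (a b : Fin 4) → c * r ^ toℕ a ≋ c * r ^ toℕ b → a ≡ b
  ^-injective c≢0 a b crᵃ≋crᵇ with <-cmp (toℕ a) (toℕ b)
  ... | tri< a<b _ _ = ⊥-elim (^-injective-< c≢0 a<b (toℕ<n b) crᵃ≋crᵇ)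
  ... | tri≈ _ a≡b _ = toℕ-injective a≡b
  ... | tri> _ _ b<a = ⊥-elim (^-injective-< c≢0 b<a (toℕ<n a) (sym crᵃ≋crᵇ))

lemma6p2 : (q r : ℕ) → .{{_ : NonZero q}} → Prime q → q ≢ 2 →
    1 ≤ r → r ≤ q ∸ 1 → q ∣ (r * r + 1) →
    (S : List (Metacyclic.G q r)) →
    Metacyclic.SQ.MinimalProductOne q r (Metacyclic.φSeq q r S) →
    Metacyclic.SG._∈π_ q r (Metacyclic.one q r) S
    ⊎ (∃ λ (L : List (Metacyclic.G q r)) →
         Unique L × length S ≤ length L × All (λ g → Metacyclic.SG._∈π_ q r g S) L)
lemma6p2 q r q-prime q≢2 _ _ q∣r²+1 S minimal =
  case proj₂ (SG.prod S) ≟ 0 mod q of λ where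
    (yes α≡0) → inj₁ (S , ↭-refl , cong₂ _,_ (minimal⇒τ-exp≡0 minimal) α≡0)
    (no α≢0)  → inj₂ (rotations S , rotations-unique α≢0 ,
                      ≤-reflexive (sym (length-rotations S)) , rotations-∈π S)
  where
  open Metacyclic q r
  open Congruence q
  open ModularAddition q using (toℕ-mod; toℕ-≋-injective)
  open OrderFour q r q-prime q≢2 q∣r²+1
  open MetacyclicProducts q r r⁴≋1
  open Rotations _·_ one

  αPower-injective : ¬ proj₂ (SG.prod S) ≡ 0 mod q →
                     ∀ {a b} → αPower (α-exp S) a ≡ αPower (α-exp S) b → a ≡ b
  αPower-injective α≢0 {a} {b} eq = ^-injective c≢0 a b
    (trans (sym (toℕ-mod _)) (trans (≡⇒≋ (cong (toℕ ∘ proj₂) eq)) (toℕ-mod _)))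
    where
    c≢0 : ¬ α-exp S ≋ 0
    c≢0 α≋0 = α≢0 (toℕ-≋-injective (trans α≋0 (sym (toℕ-mod 0))))

  rotations-unique : ¬ proj₂ (SG.prod S) ≡ 0 mod q → Unique (rotations S)
  rotations-unique α≢0 = subst Unique
    (sym (trans (map-cong-local (rotations-as-αPowers S (minimal⇒τ-exp≡0 minimal))) (map-∘ (splits S))))
    (Unique.map⁺ (αPower-injective α≢0) (minimal⇒prefix-τ-exps-unique minimal))
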